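{- Let $A$ be a meet-complemented lattice in which both $\Box a$ and $\Diamond a$ exist for every $a\in A$. Then for every $a\in A$: (i) $\Diamond a\le\neg\Box\neg a$; (ii) $\neg\Diamond a=\Box\neg a$; (iii) $\neg\neg\Diamond a=\neg\Box\neg a$; (iv) $\Box\neg\neg a=\neg\Diamond\neg a$; (v) $\Diamond\neg a\le\neg\Box a$; (vi) $\Box a\le\neg\Diamond\neg a$; (vii) $\neg\Diamond\neg a\le\Box\Diamond a$; (viii) $\Box\neg a\le\neg\Box\Diamond a$; (ix) $\Box\Diamond a\le\neg\Box\neg a$; (x) $\Diamond\neg\Box\neg a=\Diamond\Diamond a$.
   Context: A meet-complemented lattice is a lattice $(A,\wedge,\vee)$, not necessarily distributive, such that for every $a\in A$ the element $\neg a=\max\{b\in A: a\wedge b\le c\text{ for all }c\in A\}$ exists; it is bounded, with least element $0$ and greatest element $1$. For $a\in A$, $\Box a=\max\{b\in A: a\vee\neg b=1\}$ and $\Diamond a=\min\{b\in A: \neg a\vee b=1\}$. -}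

module Defs where

open import Level using (Level; _⊔_)
open import Data.Product using (_×_)
open import Relation.Binary.Lattice.Bundles using (BoundedLattice)

module _ {c ℓ₁ ℓ₂ : Level} (L : BoundedLattice c ℓ₁ ℓ₂) where
  open BoundedLattice L

  IsMeetComplement : (Carrier → Carrier) → Set (c ⊔ ℓ₂)
  IsMeetComplement ng =
    ∀ a → ((∀ d → (a ∧ ng a) ≤ d)
          × (∀ b → (∀ d → (a ∧ b) ≤ d) → b ≤ ng a))

  IsBox : (Carrier → Carrier) → (Carrier → Carrier) → Set (c ⊔ ℓ₁ ⊔ ℓ₂)
  IsBox ng box =
    ∀ a → ((a ∨ ng (box a)) ≈ ⊤)
          × (∀ b → (a ∨ ng b) ≈ ⊤ → b ≤ box a)

  IsDiamond : (Carrier → Carrier) → (Carrier → Carrier) → Set (c ⊔ ℓ₁ ⊔ ℓ₂)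
  IsDiamond ng dia =
    ∀ a → ((ng a ∨ dia a) ≈ ⊤)
          × (∀ b → (ng a ∨ b) ≈ ⊤ → dia a ≤ b)

-- The lattice need not be distributive, so the only tools are the defining
-- (Galois-style) properties of the three operations:
--   b ≤ ¬ a  iff  a ∧ b ≤ ⊥,   b ≤ □ a  iff  a ∨ ¬ b ≈ ⊤,   ◇ a ≤ b  iff  ¬ a ∨ b ≈ ⊤.  The key item is (ii), ¬ ◇ a ≈ □ ¬ a, which
-- follows from (i) by the Galois property of ¬ and from the universal property
-- of □.
module Submission where

open import Defs
open import Data.Product using (_×_; _,_; proj₁; proj₂)
open import Relation.Binary.Lattice.Bundles using (BoundedLattice)
import Relation.Binary.Lattice.Properties.MeetSemilattice as MeetProperties
import Relation.Binary.Reasoning.PartialOrder as PosetReasoning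

module BoundedLatticeFacts {c ℓ₁ ℓ₂} (L : BoundedLattice c ℓ₁ ℓ₂) where
  open BoundedLattice L

  ⊤-above-join : ∀ {x y z} → (x ∨ y) ≈ ⊤ → x ≤ z → y ≤ z → z ≈ ⊤
  ⊤-above-join {x} {y} {z} x∨y≈⊤ x≤z y≤z =
    antisym (maximum z) (trans (reflexive (Eq.sym x∨y≈⊤)) (∨-least x≤z y≤z))

module MeetComplemented {c ℓ₁ ℓ₂} (L : BoundedLattice c ℓ₁ ℓ₂)
  {ng : BoundedLattice.Carrier L → BoundedLattice.Carrier L}
  (mc : IsMeetComplement L ng) where
  open BoundedLattice L
  open BoundedLatticeFacts L
  open MeetProperties meetSemilattice using (∧-comm)
  open PosetReasoning poset

  ¬-contradiction : ∀ a → (a ∧ ng a) ≤ ⊥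
  ¬-contradiction a = proj₁ (mc a) ⊥

  ¬-greatest : ∀ {a b} → (a ∧ b) ≤ ⊥ → b ≤ ng a
  ¬-greatest {a} {b} a∧b≤⊥ = proj₂ (mc a) b (λ d → trans a∧b≤⊥ (minimum d))

  ¬-galois : ∀ {a b} → b ≤ ng a → a ≤ ng b
  ¬-galois {a} {b} b≤¬a = ¬-greatest (begin
    b ∧ a      ≈⟨ ∧-comm b a ⟩
    a ∧ b      ≤⟨ ∧-greatest (x∧y≤x a b) (trans (x∧y≤y a b) b≤¬a) ⟩
    a ∧ ng a   ≤⟨ ¬-contradiction a ⟩
    ⊥          ∎)

  ¬¬-intro : ∀ {a} → a ≤ ng (ng a)
  ¬¬-intro = ¬-galois refl

  ¬-antitone : ∀ {a b} → a ≤ b → ng b ≤ ng a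
  ¬-antitone a≤b = ¬-galois (trans a≤b ¬¬-intro)

  ¬-cong : ∀ {a b} → a ≈ b → ng a ≈ ng b
  ¬-cong a≈b = antisym (¬-antitone (reflexive (Eq.sym a≈b))) (¬-antitone (reflexive a≈b))

  ¬¬¬-elim : ∀ {a} → ng (ng (ng a)) ≈ ng a
  ¬¬¬-elim = antisym (¬-antitone ¬¬-intro) ¬¬-intro

  ≤¬-self⇒≤⊥ : ∀ {z} → z ≤ ng z → z ≤ ⊥
  ≤¬-self⇒≤⊥ {z} z≤¬z = trans (∧-greatest refl z≤¬z) (¬-contradiction z)

  -- If x ∨ y ≈ ⊤ then ¬ x and ¬ y are disjoint, hence ¬ y ≤ ¬¬ x.
  -- (The meet z = ¬ x ∧ ¬ y lies below ¬ x and ¬ y, so x, y ≤ ¬ z and ¬ z ≈ ⊤.)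
  join-⊤⇒¬≤¬¬ : ∀ {x y} → (x ∨ y) ≈ ⊤ → ng y ≤ ng (ng x)
  join-⊤⇒¬≤¬¬ {x} {y} x∨y≈⊤ = ¬-greatest (≤¬-self⇒≤⊥ z≤¬z)
    where
      z : Carrier
      z = ng x ∧ ng y
      ¬z≈⊤ : ng z ≈ ⊤
      ¬z≈⊤ = ⊤-above-join x∨y≈⊤ (¬-galois (x∧y≤x _ _)) (¬-galois (x∧y≤y _ _))
      z≤¬z : z ≤ ng z
      z≤¬z = trans (maximum z) (reflexive (Eq.sym ¬z≈⊤))

module BoxFacts {c ℓ₁ ℓ₂} (L : BoundedLattice c ℓ₁ ℓ₂)
  {ng box : BoundedLattice.Carrier L → BoundedLattice.Carrier L}
  (mc : IsMeetComplement L ng) (bx : IsBox L ng box) where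
  open BoundedLattice L
  open BoundedLatticeFacts L
  open MeetComplemented L mc

  □-covers : ∀ a → (a ∨ ng (box a)) ≈ ⊤
  □-covers a = proj₁ (bx a)

  □-greatest : ∀ {a b} → (a ∨ ng b) ≈ ⊤ → b ≤ box a
  □-greatest {a} {b} = proj₂ (bx a) b

  □-monotone : ∀ {a b} → a ≤ b → box a ≤ box b
  □-monotone a≤b = □-greatest
    (⊤-above-join (□-covers _) (trans a≤b (x≤x∨y _ _)) (y≤x∨y _ _))

  □≤¬¬ : ∀ a → box a ≤ ng (ng a)
  □≤¬¬ a = trans ¬¬-intro (join-⊤⇒¬≤¬¬ (□-covers a))

module DiamondFacts {c ℓ₁ ℓ₂} (L : BoundedLattice c ℓ₁ ℓ₂)
  {ng dia : BoundedLattice.Carrier L → BoundedLattice.Carrier L}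
  (mc : IsMeetComplement L ng) (dg : IsDiamond L ng dia) where
  open BoundedLattice L
  open BoundedLatticeFacts L
  open MeetComplemented L mc

  ◇-covers : ∀ a → (ng a ∨ dia a) ≈ ⊤
  ◇-covers a = proj₁ (dg a)

  ◇-least : ∀ {a b} → (ng a ∨ b) ≈ ⊤ → dia a ≤ b
  ◇-least {a} {b} = proj₂ (dg a) b

  ◇≤⇒covers : ∀ {a b} → dia a ≤ b → (ng a ∨ b) ≈ ⊤
  ◇≤⇒covers ◇a≤b = ⊤-above-join (◇-covers _) (x≤x∨y _ _) (trans ◇a≤b (y≤x∨y _ _))

  ◇-antitone-in-¬ : ∀ {a b} → ng b ≤ ng a → dia a ≤ dia b
  ◇-antitone-in-¬ ¬b≤¬a =
    ◇-least (⊤-above-join (◇-covers _) (trans ¬b≤¬a (x≤x∨y _ _)) (y≤x∨y _ _))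

  ◇-cong-in-¬ : ∀ {a b} → ng a ≈ ng b → dia a ≈ dia b
  ◇-cong-in-¬ ¬a≈¬b =
    antisym (◇-antitone-in-¬ (reflexive (Eq.sym ¬a≈¬b))) (◇-antitone-in-¬ (reflexive ¬a≈¬b))

  ¬◇≤¬ : ∀ a → ng (dia a) ≤ ng a
  ¬◇≤¬ a = trans (join-⊤⇒¬≤¬¬ (◇-covers a)) (reflexive ¬¬¬-elim)

module Proposition9 {c ℓ₁ ℓ₂} (L : BoundedLattice c ℓ₁ ℓ₂)
  {ng box dia : BoundedLattice.Carrier L → BoundedLattice.Carrier L}
  (mc : IsMeetComplement L ng) (bx : IsBox L ng box) (dg : IsDiamond L ng dia) where
  open BoundedLattice L
  open BoundedLatticeFacts L
  open MeetComplemented L mc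
  open BoxFacts L mc bx
  open DiamondFacts L mc dg
  open PosetReasoning poset

  -- (i): ¬ □ ¬ a is one of the elements whose minimum defines ◇ a.
  ◇≤¬□¬ : ∀ a → dia a ≤ ng (box (ng a))
  ◇≤¬□¬ a = ◇-least (□-covers (ng a))

  -- (ii): ≥ is (i) through the Galois property; ≤ because ¬ a ∨ ¬¬ ◇ a ≈ ⊤.
  ¬◇≈□¬ : ∀ a → ng (dia a) ≈ box (ng a)
  ¬◇≈□¬ a = antisym (□-greatest (◇≤⇒covers ¬¬-intro)) (¬-galois (◇≤¬□¬ a))

  -- (vi): □ is monotone and a ≤ ¬¬ a; then rewrite □ ¬¬ a by (ii).
  □≤¬◇¬ : ∀ a → box a ≤ ng (dia (ng a))
  □≤¬◇¬ a = trans (□-monotone ¬¬-intro) (reflexive (Eq.sym (¬◇≈□¬ (ng a))))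

  -- (vii): ¬ ◇ ¬ a ≤ □ ◇ a since ◇ a ∨ ¬¬ ◇ ¬ a lies above ¬ a ∨ ◇ a ≈ ⊤.
  ¬◇¬≤□◇ : ∀ a → ng (dia (ng a)) ≤ box (dia a)
  ¬◇¬≤□◇ a = □-greatest (⊤-above-join (◇-covers a) ¬a≤¬¬◇¬a (x≤x∨y _ _))
    where
      ¬a≤¬¬◇¬a : ng a ≤ (dia a ∨ ng (ng (dia (ng a))))
      ¬a≤¬¬◇¬a = begin
        ng a                       ≤⟨ ¬¬-intro ⟩
        ng (ng (ng a))             ≤⟨ ¬-antitone (¬◇≤¬ (ng a)) ⟩
        ng (ng (dia (ng a)))       ≤⟨ y≤x∨y _ _ ⟩
        dia a ∨ ng (ng (dia (ng a))) ∎

  -- (ix): □ ◇ a ≤ ¬¬ ◇ a, and ¬¬ ◇ a ≈ ¬ □ ¬ a by (ii).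
  □◇≤¬□¬ : ∀ a → box (dia a) ≤ ng (box (ng a))
  □◇≤¬□¬ a = trans (□≤¬¬ (dia a)) (reflexive (¬-cong (¬◇≈□¬ a)))

  -- (x): ◇ only sees complements, and ¬ ¬ □ ¬ a ≈ ¬¬¬ ◇ a ≈ ¬ ◇ a by (ii).
  ◇¬□¬≈◇◇ : ∀ a → dia (ng (box (ng a))) ≈ dia (dia a)
  ◇¬□¬≈◇◇ a = ◇-cong-in-¬ (Eq.trans (¬-cong (¬-cong (Eq.sym (¬◇≈□¬ a)))) ¬¬¬-elim)

proposition9 : ∀ {c ℓ₁ ℓ₂} (L : BoundedLattice c ℓ₁ ℓ₂) →
    let open BoundedLattice L in
    (ng box dia : Carrier → Carrier) →
    IsMeetComplement L ng → IsBox L ng box → IsDiamond L ng dia →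
    ∀ a →
      (dia a ≤ ng (box (ng a)))
      × (ng (dia a) ≈ box (ng a))
      × (ng (ng (dia a)) ≈ ng (box (ng a)))
      × (box (ng (ng a)) ≈ ng (dia (ng a)))
      × (dia (ng a) ≤ ng (box a))
      × (box a ≤ ng (dia (ng a)))
      × (ng (dia (ng a)) ≤ box (dia a))
      × (box (ng a) ≤ ng (box (dia a)))
      × (box (dia a) ≤ ng (box (ng a)))
      × (dia (ng (box (ng a))) ≈ dia (dia a))
proposition9 L ng box dia mc bx dg a =
    ◇≤¬□¬ a
  , ¬◇≈□¬ a
  , ¬-cong (¬◇≈□¬ a)
  , Eq.sym (¬◇≈□¬ (ng a))
  , ¬-galois (□≤¬◇¬ a)
  , □≤¬◇¬ a
  , ¬◇¬≤□◇ a
  , ¬-galois (□◇≤¬□¬ a)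
  , □◇≤¬□¬ a
  , ◇¬□¬≈◇◇ a
  where
    open BoundedLattice L using (module Eq)
    open MeetComplemented L mc using (¬-cong; ¬-galois)
    open Proposition9 L mc bx dg
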